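{- Let $X$ be a finite non-empty set, $x\in X$, and $R=\{\emptyset,\{x\},X\setminus\{x\}\}$. For all $a,b\in 2^X$ with $|a|\neq|b|$ there exists $r\in R$ such that $\mathrm{Jac}(a,r)\neq\mathrm{Jac}(b,r)$.
   Context: For a finite set $X$, $2^X$ is its power set. The Jaccard distance on $2^X$ is $\mathrm{Jac}(a,b)=|a\,\Delta\, b|/|a\cup b|$ for $a\neq b$ and $\mathrm{Jac}(a,a)=0$, where $\Delta$ is symmetric difference. -}

module Defs where

open import Data.Nat using (ℕ; zero; suc)
open import Data.Bool using (Bool)
import Data.Bool.Properties as BoolP
open import Data.Integer using (+_)
open import Data.Rational using (ℚ; _/_; 0ℚ)
open import Data.Fin.Subset using (Subset; _∪_; _─_; ∣_∣)
open import Data.Vec.Properties using (≡-dec)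
open import Relation.Nullary using (yes; no)

_Δ_ : ∀ {n} → Subset n → Subset n → Subset n
a Δ b = (a ─ b) ∪ (b ─ a)

-- Jaccard distance: Jac(a,a) = 0, and for a ≠ b, |a Δ b| / |a ∪ b|.
-- (For a ≠ b, a ∪ b is nonempty; the zero branch below is unreachable then.)
Jac : ∀ {n} → Subset n → Subset n → ℚ
Jac a b with ≡-dec BoolP._≟_ a b
... | yes _ = 0ℚ
... | no _ with ∣ a ∪ b ∣
...   | zero  = 0ℚ
...   | suc k = (+ ∣ a Δ b ∣) / suc k

{-# OPTIONS --safe #-}
-- Jac p q = |p Δ q| / |p ∪ q| and |p Δ q| = |p ∪ q| - |p ∩ q|, so equal Jaccard
-- distances force the Jaccard similarities |p ∩ q| / |p ∪ q| to agree.  If x lies in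
-- exactly one of a, b, then r = {x} meets one and misses the other, so one distance
-- is 1 and the other is not.  Otherwise a and b agree on {x}, hence a ∪ r = b ∪ r for
-- r = X ∖ {x}; equal distances then give |a ∖ {x}| = |b ∖ {x}|, and so |a| = |b|.
module Submission where

open import Data.Bool.Properties using () renaming (_≟_ to _≟ᵇ_)
open import Data.Fin using (Fin; zero; suc)
open import Data.Fin.Subset
  using (Subset; ⊥; ⊤; ⁅_⁆; ∁; ∣_∣; _∪_; _∩_; _∈_; _∉_; inside; outside)
open import Data.Fin.Subset.Properties
  using (_∈?_; ∣⊥∣≡0; ∣⁅x⁆∣≡1; ∣p∩q∣≤∣p∣; ∣p∣≤∣p∪q∣; ∣q∣≤∣p∪q∣; p∪∁p≡⊤;
         ∩-comm; ∩-zeroˡ; ∩-identityˡ; ∪-distribʳ-∩)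
open import Data.Integer using (+_)
open import Data.Nat using (ℕ; zero; suc; _+_; _*_; _≤_)
open import Data.Nat.Properties
  using (+-suc; +-cancelˡ-≡; *-comm; *-zeroʳ; *-distribʳ-+; *-cancelʳ-≡;
         ≤-trans; n≤0⇒n≡0; m*n≡0⇒m≡0∨n≡0)
open import Data.Product using (∃; _×_; _,_)
open import Data.Rational using (_/_)
open import Data.Rational.Properties using (0/n≡0; normalize-injective-≃)
open import Data.Sum using (_⊎_; inj₁; inj₂; [_,_]′)
open import Data.Vec.Base using (_∷_; []; here; there)
open import Data.Vec.Properties using (≡-dec)
open import Function using (_∘_)
open import Relation.Binary.PropositionalEquality
  using (_≡_; _≢_; refl; sym; trans; cong; cong₂; subst; module ≡-Reasoning)
open import Relation.Nullary using (yes; no; contradiction)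

open import Defs

private
  variable
    n : ℕ

∣pΔp∣≡0 : (p : Subset n) → ∣ p Δ p ∣ ≡ 0
∣pΔp∣≡0 []            = refl
∣pΔp∣≡0 (inside  ∷ p) = ∣pΔp∣≡0 p
∣pΔp∣≡0 (outside ∷ p) = ∣pΔp∣≡0 p

∣pΔq∣+∣p∩q∣≡∣p∪q∣ : (p q : Subset n) → ∣ p Δ q ∣ + ∣ p ∩ q ∣ ≡ ∣ p ∪ q ∣
∣pΔq∣+∣p∩q∣≡∣p∪q∣ []            []            = refl
∣pΔq∣+∣p∩q∣≡∣p∪q∣ (inside  ∷ p) (inside  ∷ q) =
  trans (+-suc _ _) (cong suc (∣pΔq∣+∣p∩q∣≡∣p∪q∣ p q))
∣pΔq∣+∣p∩q∣≡∣p∪q∣ (inside  ∷ p) (outside ∷ q) = cong suc (∣pΔq∣+∣p∩q∣≡∣p∪q∣ p q)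
∣pΔq∣+∣p∩q∣≡∣p∪q∣ (outside ∷ p) (inside  ∷ q) = cong suc (∣pΔq∣+∣p∩q∣≡∣p∪q∣ p q)
∣pΔq∣+∣p∩q∣≡∣p∪q∣ (outside ∷ p) (outside ∷ q) = ∣pΔq∣+∣p∩q∣≡∣p∪q∣ p q

∣p∩q∣+∣p∩∁q∣≡∣p∣ : (p q : Subset n) → ∣ p ∩ q ∣ + ∣ p ∩ ∁ q ∣ ≡ ∣ p ∣
∣p∩q∣+∣p∩∁q∣≡∣p∣ []            []            = refl
∣p∩q∣+∣p∩∁q∣≡∣p∣ (inside  ∷ p) (inside  ∷ q) = cong suc (∣p∩q∣+∣p∩∁q∣≡∣p∣ p q)
∣p∩q∣+∣p∩∁q∣≡∣p∣ (inside  ∷ p) (outside ∷ q) =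
  trans (+-suc _ _) (cong suc (∣p∩q∣+∣p∩∁q∣≡∣p∣ p q))
∣p∩q∣+∣p∩∁q∣≡∣p∣ (outside ∷ p) (_       ∷ q) = ∣p∩q∣+∣p∩∁q∣≡∣p∣ p q

∣p∪q∣≡0⇒∣p∩q∣≡0 : (p q : Subset n) → ∣ p ∪ q ∣ ≡ 0 → ∣ p ∩ q ∣ ≡ 0
∣p∪q∣≡0⇒∣p∩q∣≡0 p q eq =
  n≤0⇒n≡0 (subst (∣ p ∩ q ∣ ≤_) eq (≤-trans (∣p∩q∣≤∣p∣ p q) (∣p∣≤∣p∪q∣ p q)))

∣p∪q∣≡0⇒∣q∣≡0 : (p q : Subset n) → ∣ p ∪ q ∣ ≡ 0 → ∣ q ∣ ≡ 0
∣p∪q∣≡0⇒∣q∣≡0 p q eq = n≤0⇒n≡0 (subst (∣ q ∣ ≤_) eq (∣q∣≤∣p∪q∣ p q))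

x∈p⇒⁅x⁆∩p≡⁅x⁆ : {x : Fin n} {p : Subset n} → x ∈ p → ⁅ x ⁆ ∩ p ≡ ⁅ x ⁆
x∈p⇒⁅x⁆∩p≡⁅x⁆ {p = _ ∷ p} here        = cong (inside ∷_) (∩-zeroˡ p)
x∈p⇒⁅x⁆∩p≡⁅x⁆             (there x∈p) = cong (outside ∷_) (x∈p⇒⁅x⁆∩p≡⁅x⁆ x∈p)

x∉p⇒⁅x⁆∩p≡⊥ : {x : Fin n} {p : Subset n} → x ∉ p → ⁅ x ⁆ ∩ p ≡ ⊥
x∉p⇒⁅x⁆∩p≡⊥ {x = zero}  {outside ∷ p} _   = cong (outside ∷_) (∩-zeroˡ p)
x∉p⇒⁅x⁆∩p≡⊥ {x = zero}  {inside  ∷ p} x∉p = contradiction here x∉p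
x∉p⇒⁅x⁆∩p≡⊥ {x = suc x} {_       ∷ p} x∉p = cong (outside ∷_) (x∉p⇒⁅x⁆∩p≡⊥ (x∉p ∘ there))

Jac≡∣Δ∣/∣∪∣ : (p q : Subset n) {k : ℕ} → ∣ p ∪ q ∣ ≡ suc k → Jac p q ≡ (+ ∣ p Δ q ∣) / suc k
Jac≡∣Δ∣/∣∪∣ p q {k} eq with ≡-dec _≟ᵇ_ p q
... | yes refl rewrite ∣pΔp∣≡0 p = sym (0/n≡0 (suc k))
... | no _ rewrite eq = refl

-- Equal distances give equal similarities |p ∩ q| / |p ∪ q|, cross-multiplied so that
-- no non-emptiness hypothesis is needed.
Jac≡⇒∣∩∣*∣∪∣≡ : ∀ {m n} (p q : Subset m) (p′ q′ : Subset n) → Jac p q ≡ Jac p′ q′ →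
                ∣ p ∩ q ∣ * ∣ p′ ∪ q′ ∣ ≡ ∣ p′ ∩ q′ ∣ * ∣ p ∪ q ∣
Jac≡⇒∣∩∣*∣∪∣≡ p q p′ q′ eq with ∣ p ∪ q ∣ in u | ∣ p′ ∪ q′ ∣ in u′
... | zero  | _     rewrite ∣p∪q∣≡0⇒∣p∩q∣≡0 p q u = sym (*-zeroʳ ∣ p′ ∩ q′ ∣)
... | suc _ | zero  rewrite ∣p∪q∣≡0⇒∣p∩q∣≡0 p′ q′ u′ = *-zeroʳ ∣ p ∩ q ∣
... | suc k | suc k′ = begin
  i * K′                ≡⟨ +-cancelˡ-≡ (d * K′) _ _ (begin
    d * K′ + i * K′       ≡⟨ sym (*-distribʳ-+ K′ d i) ⟩
    (d + i) * K′          ≡⟨ cong (_* K′) (trans (∣pΔq∣+∣p∩q∣≡∣p∪q∣ p q) u) ⟩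
    K * K′                ≡⟨ *-comm K K′ ⟩
    K′ * K                ≡⟨ cong (_* K) (sym (trans (∣pΔq∣+∣p∩q∣≡∣p∪q∣ p′ q′) u′)) ⟩
    (d′ + i′) * K         ≡⟨ *-distribʳ-+ K d′ i′ ⟩
    d′ * K + i′ * K       ≡⟨ cong (_+ i′ * K) (sym d*K′≡d′*K) ⟩
    d * K′ + i′ * K       ∎) ⟩
  i′ * K                ∎
  where
  open ≡-Reasoning
  K = suc k
  K′ = suc k′
  d = ∣ p Δ q ∣
  i = ∣ p ∩ q ∣
  d′ = ∣ p′ Δ q′ ∣
  i′ = ∣ p′ ∩ q′ ∣
  d*K′≡d′*K : d * K′ ≡ d′ * K
  d*K′≡d′*K = normalize-injective-≃ d d′ K K′
    (trans (sym (Jac≡∣Δ∣/∣∪∣ p q u)) (trans eq (Jac≡∣Δ∣/∣∪∣ p′ q′ u′)))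

Jac≡⇒∣∩∣≡ : (p q p′ q′ : Subset n) → ∣ p ∪ q ∣ ≡ ∣ p′ ∪ q′ ∣ → Jac p q ≡ Jac p′ q′ →
            ∣ p ∩ q ∣ ≡ ∣ p′ ∩ q′ ∣
Jac≡⇒∣∩∣≡ p q p′ q′ u≡u′ eq with ∣ p ∪ q ∣ in u
... | zero  = trans (∣p∪q∣≡0⇒∣p∩q∣≡0 p q u) (sym (∣p∪q∣≡0⇒∣p∩q∣≡0 p′ q′ (sym u≡u′)))
... | suc k = *-cancelʳ-≡ _ _ (suc k) (begin
  ∣ p ∩ q ∣ * suc k          ≡⟨ cong (∣ p ∩ q ∣ *_) u≡u′ ⟩
  ∣ p ∩ q ∣ * ∣ p′ ∪ q′ ∣    ≡⟨ Jac≡⇒∣∩∣*∣∪∣≡ p q p′ q′ eq ⟩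
  ∣ p′ ∩ q′ ∣ * ∣ p ∪ q ∣    ≡⟨ cong (∣ p′ ∩ q′ ∣ *_) u ⟩
  ∣ p′ ∩ q′ ∣ * suc k        ∎)
  where open ≡-Reasoning

∣⁅x⁆∣≢0 : (x : Fin n) → ∣ ⁅ x ⁆ ∣ ≢ 0
∣⁅x⁆∣≢0 x = subst (_≢ 0) (sym (∣⁅x⁆∣≡1 x)) λ ()

-- s ∩ p ≡ s says s ⊆ p; then Jac p s < 1 = Jac q s.
s⊆p∧s∩q≡⊥⇒Jac≢ : (p q s : Subset n) → ∣ s ∣ ≢ 0 → s ∩ p ≡ s → s ∩ q ≡ ⊥ →
                 Jac p s ≢ Jac q s
s⊆p∧s∩q≡⊥⇒Jac≢ {n} p q s ∣s∣≢0 s∩p≡s s∩q≡⊥ eq =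
  [ ∣s∣≢0 , ∣s∣≢0 ∘ ∣p∪q∣≡0⇒∣q∣≡0 q s ]′ (m*n≡0⇒m≡0∨n≡0 ∣ s ∣ ∣s∣*∣q∪s∣≡0)
  where
  open ≡-Reasoning
  ∣s∣*∣q∪s∣≡0 : ∣ s ∣ * ∣ q ∪ s ∣ ≡ 0
  ∣s∣*∣q∪s∣≡0 = begin
    ∣ s ∣ * ∣ q ∪ s ∣      ≡⟨ cong (λ t → ∣ t ∣ * ∣ q ∪ s ∣) (sym (trans (∩-comm p s) s∩p≡s)) ⟩
    ∣ p ∩ s ∣ * ∣ q ∪ s ∣  ≡⟨ Jac≡⇒∣∩∣*∣∪∣≡ p s q s eq ⟩
    ∣ q ∩ s ∣ * ∣ p ∪ s ∣  ≡⟨ cong (λ t → ∣ t ∣ * ∣ p ∪ s ∣) (trans (∩-comm q s) s∩q≡⊥) ⟩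
    ∣ ⊥ {n} ∣ * ∣ p ∪ s ∣  ≡⟨ cong (_* ∣ p ∪ s ∣) (∣⊥∣≡0 n) ⟩
    0                      ∎

s∩p≡s∩q∧Jac∁s≡⇒∣p∣≡∣q∣ : (p q s : Subset n) → s ∩ p ≡ s ∩ q →
                          Jac p (∁ s) ≡ Jac q (∁ s) → ∣ p ∣ ≡ ∣ q ∣
s∩p≡s∩q∧Jac∁s≡⇒∣p∣≡∣q∣ p q s agree eq = begin
  ∣ p ∣                      ≡⟨ sym (∣p∩q∣+∣p∩∁q∣≡∣p∣ p s) ⟩
  ∣ p ∩ s ∣ + ∣ p ∩ ∁ s ∣    ≡⟨ cong₂ _+_ (cong ∣_∣ p∩s≡q∩s)
                                  (Jac≡⇒∣∩∣≡ p (∁ s) q (∁ s) (cong ∣_∣ p∪∁s≡q∪∁s) eq) ⟩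
  ∣ q ∩ s ∣ + ∣ q ∩ ∁ s ∣    ≡⟨ ∣p∩q∣+∣p∩∁q∣≡∣p∣ q s ⟩
  ∣ q ∣                      ∎
  where
  open ≡-Reasoning
  p∩s≡q∩s : p ∩ s ≡ q ∩ s
  p∩s≡q∩s = trans (∩-comm p s) (trans agree (∩-comm s q))
  ∪∁s≡∩s∪∁s : (t : Subset _) → t ∪ ∁ s ≡ (s ∩ t) ∪ ∁ s
  ∪∁s≡∩s∪∁s t = sym (begin
    (s ∩ t) ∪ ∁ s          ≡⟨ ∪-distribʳ-∩ (∁ s) s t ⟩
    (s ∪ ∁ s) ∩ (t ∪ ∁ s)  ≡⟨ cong (_∩ (t ∪ ∁ s)) (p∪∁p≡⊤ s) ⟩
    ⊤ ∩ (t ∪ ∁ s)          ≡⟨ ∩-identityˡ (t ∪ ∁ s) ⟩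
    t ∪ ∁ s                ∎)
  p∪∁s≡q∪∁s : p ∪ ∁ s ≡ q ∪ ∁ s
  p∪∁s≡q∪∁s = trans (∪∁s≡∩s∪∁s p) (trans (cong (_∪ ∁ s) agree) (sym (∪∁s≡∩s∪∁s q)))

lemma1 : (m : ℕ) (x : Fin (suc m)) (a b : Subset (suc m)) →
    ∣ a ∣ ≢ ∣ b ∣ →
    ∃ λ (r : Subset (suc m)) → (r ≡ ⊥ ⊎ r ≡ ⁅ x ⁆ ⊎ r ≡ ∁ ⁅ x ⁆) × Jac a r ≢ Jac b r
lemma1 m x a b ∣a∣≢∣b∣ with x ∈? a | x ∈? b
... | yes x∈a | yes x∈b = ∁ ⁅ x ⁆ , inj₂ (inj₂ refl) ,
  ∣a∣≢∣b∣ ∘ s∩p≡s∩q∧Jac∁s≡⇒∣p∣≡∣q∣ a b ⁅ x ⁆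
    (trans (x∈p⇒⁅x⁆∩p≡⁅x⁆ x∈a) (sym (x∈p⇒⁅x⁆∩p≡⁅x⁆ x∈b)))
... | no x∉a  | no x∉b  = ∁ ⁅ x ⁆ , inj₂ (inj₂ refl) ,
  ∣a∣≢∣b∣ ∘ s∩p≡s∩q∧Jac∁s≡⇒∣p∣≡∣q∣ a b ⁅ x ⁆
    (trans (x∉p⇒⁅x⁆∩p≡⊥ x∉a) (sym (x∉p⇒⁅x⁆∩p≡⊥ x∉b)))
... | yes x∈a | no x∉b  = ⁅ x ⁆ , inj₂ (inj₁ refl) ,
  s⊆p∧s∩q≡⊥⇒Jac≢ a b ⁅ x ⁆ (∣⁅x⁆∣≢0 x) (x∈p⇒⁅x⁆∩p≡⁅x⁆ x∈a) (x∉p⇒⁅x⁆∩p≡⊥ x∉b)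
... | no x∉a  | yes x∈b = ⁅ x ⁆ , inj₂ (inj₁ refl) ,
  s⊆p∧s∩q≡⊥⇒Jac≢ b a ⁅ x ⁆ (∣⁅x⁆∣≢0 x) (x∈p⇒⁅x⁆∩p≡⁅x⁆ x∈b) (x∉p⇒⁅x⁆∩p≡⊥ x∉a) ∘ sym
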